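{- Let $L$ be a lattice with canonical extension $L^\delta$. If $k\in K(L^\delta)$ is finitely prime, then $k\in J^\infty(L^\delta)$, i.e. $k$ is completely join-irreducible in $L^\delta$.
   Context: For a (bounded) lattice $L$, the canonical extension $L^\delta$ is a complete lattice containing $L$ as a sublattice such that (denseness) every element of $L^\delta$ is a join of meets of elements of $L$ and also a meet of joins of elements of $L$, and (compactness) whenever $S,T\subseteq L$ satisfy $\bigwedge S\leq\bigvee T$ in $L^\delta$, there are finite $S'\subseteq S$, $T'\subseteq T$ with $\bigwedge S'\leq \bigvee T'$. $K(L^\delta)$ denotes the set of elements of $L^\delta$ that are meets of subsets of $L$. An element $u\in L^\delta$ is finitely prime if $u\neq\bot$ and for all $v,w\in L^\delta$, $u\leq v\vee w$ implies $u\leq v$ or $u\leq w$. $J^\infty(L^\delta)$ is the set of completely join-irreducible elements: $x$ such that for every $S\subseteq L^\delta$, $x=\bigvee S$ implies $x\in S$. -}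

module Defs where

open import Level using (Level; suc; Lift)
open import Data.Empty using (⊥)
open import Data.Sum using (_⊎_)
open import Data.Product using (Σ; ∃; _×_)
open import Data.List using (List; foldr)
open import Data.List.Relation.Unary.All using (All)
open import Relation.Unary using (Pred)
open import Relation.Binary using (Rel; IsPartialOrder)
open import Relation.Nullary using (¬_)
open import Relation.Binary.Lattice using (BoundedLattice)

record CompleteLattice (ℓ : Level) : Set (suc ℓ) where
  infix 4 _≈_ _≤_
  field
    Carrier        : Set ℓ
    _≈_            : Rel Carrier ℓ
    _≤_            : Rel Carrier ℓ
    isPartialOrder : IsPartialOrder _≈_ _≤_
    ⋁              : Pred Carrier ℓ → Carrier
    ⋀              : Pred Carrier ℓ → Carrier
    ⋁-upper        : ∀ (S : Pred Carrier ℓ) x → S x → x ≤ ⋁ S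
    ⋁-least        : ∀ (S : Pred Carrier ℓ) y → (∀ x → S x → x ≤ y) → ⋁ S ≤ y
    ⋀-lower        : ∀ (S : Pred Carrier ℓ) x → S x → ⋀ S ≤ x
    ⋀-greatest     : ∀ (S : Pred Carrier ℓ) y → (∀ x → S x → y ≤ x) → y ≤ ⋀ S

  infixr 6 _∨_
  infixr 7 _∧_
  _∨_ : Carrier → Carrier → Carrier
  x ∨ y = ⋁ (λ z → z ≈ x ⊎ z ≈ y)

  _∧_ : Carrier → Carrier → Carrier
  x ∧ y = ⋀ (λ z → z ≈ x ⊎ z ≈ y)

  ⊥C : Carrier
  ⊥C = ⋁ (λ _ → Lift ℓ ⊥)

  ⊤C : Carrier
  ⊤C = ⋀ (λ _ → Lift ℓ ⊥)

module _ {ℓ : Level} (L : BoundedLattice ℓ ℓ ℓ) (C : CompleteLattice ℓ) where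
  private
    module L = BoundedLattice L
    module C = CompleteLattice C

  ⋀L-fin : List L.Carrier → L.Carrier
  ⋀L-fin = foldr L._∧_ L.⊤

  ⋁L-fin : List L.Carrier → L.Carrier
  ⋁L-fin = foldr L._∨_ L.⊥

  module _ (e : L.Carrier → C.Carrier) where

    image : Pred L.Carrier ℓ → Pred C.Carrier ℓ
    image S c = Σ L.Carrier (λ a → S a × e a C.≈ c)

    -- K(L^δ): elements that are meets of subsets of L
    IsClosed : C.Carrier → Set (suc ℓ)
    IsClosed x = Σ (Pred L.Carrier ℓ) (λ S → x C.≈ C.⋀ (image S))

    IsOpen : C.Carrier → Set (suc ℓ)
    IsOpen x = Σ (Pred L.Carrier ℓ) (λ S → x C.≈ C.⋁ (image S))

    record IsCanonicalExtension : Set (suc ℓ) where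
      field
        e-cong       : ∀ {a b} → a L.≈ b → e a C.≈ e b
        e-mono       : ∀ {a b} → a L.≤ b → e a C.≤ e b
        e-reflect    : ∀ {a b} → e a C.≤ e b → a L.≤ b
        e-∧          : ∀ a b → e (a L.∧ b) C.≈ (e a C.∧ e b)
        e-∨          : ∀ a b → e (a L.∨ b) C.≈ (e a C.∨ e b)
        e-⊤          : e L.⊤ C.≈ C.⊤C
        e-⊥          : e L.⊥ C.≈ C.⊥C
        dense-meets  : ∀ x → Σ (Pred C.Carrier ℓ)
                         (λ T → (∀ y → T y → IsClosed y) × x C.≈ C.⋁ T)
        dense-joins  : ∀ x → Σ (Pred C.Carrier ℓ)
                         (λ T → (∀ y → T y → IsOpen y) × x C.≈ C.⋀ T)
        compact      : ∀ (S T : Pred L.Carrier ℓ) →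
                         C.⋀ (image S) C.≤ C.⋁ (image T) →
                         Σ (List L.Carrier) (λ S′ → Σ (List L.Carrier) (λ T′ →
                           All S S′ × All T T′ × ⋀L-fin S′ L.≤ ⋁L-fin T′))

FinitelyPrime : ∀ {ℓ} (C : CompleteLattice ℓ) → CompleteLattice.Carrier C → Set ℓ
FinitelyPrime C u =
  ¬ (u ≈ ⊥C) × (∀ v w → u ≤ v ∨ w → u ≤ v ⊎ u ≤ w)
  where open CompleteLattice C

CompletelyJoinIrreducible : ∀ {ℓ} (C : CompleteLattice ℓ) → CompleteLattice.Carrier C → Set (suc ℓ)
CompletelyJoinIrreducible {ℓ} C x =
  ∀ (S : Pred Carrier ℓ) → x ≈ ⋁ S → Σ Carrier (λ y → S y × x ≈ y)
  where open CompleteLattice C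

-- Write k = ⋀ e[S]. If k = ⋁ T but k ≰ t for every t ∈ T, then each t, being a meet of
-- open elements, lies below an open element that k is not below, hence below
-- ⋁ e[{a ∈ L | k ≰ e a}]. So k ≤ ⋁ e[{a | k ≰ e a}], and compactness bounds a finite
-- meet of S by a finite join of such elements a; finite primeness then puts k below one
-- of them, which is absurd.
module Submission where

open import Defs
open import Level using (Level; suc; Lift; lift; lower)
open import Axiom.ExcludedMiddle using (ExcludedMiddle)
open import Axiom.DoubleNegationElimination using (em⇒dne)
open import Relation.Binary.Lattice using (BoundedLattice)
open import Data.Empty using (⊥-elim)
open import Data.Sum using (inj₁; inj₂)
open import Data.Product using (Σ; _×_; _,_)
open import Data.List using (List; []; _∷_)
open import Data.List.Relation.Unary.All using (All; []; _∷_; lookupAny)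
open import Data.List.Relation.Unary.Any as Any using (Any; here; there)
open import Relation.Nullary using (¬_; yes; no)
open import Relation.Nullary.Decidable using (map′)
open import Relation.Unary using (Pred; _⊆_)
open import Relation.Binary using (IsPartialOrder)

ExcludedMiddle-lower : ∀ {ℓ} → ExcludedMiddle (suc ℓ) → ExcludedMiddle ℓ
ExcludedMiddle-lower em = map′ lower lift em

module CompleteLatticeProperties {ℓ} (C : CompleteLattice ℓ) where
  open CompleteLattice C
  open IsPartialOrder isPartialOrder

  ⊥C-least : ∀ x → ⊥C ≤ x
  ⊥C-least x = ⋁-least _ x λ _ ()

  ⊤C-greatest : ∀ x → x ≤ ⊤C
  ⊤C-greatest x = ⋀-greatest _ x λ _ ()

  ∧-greatest : ∀ {x a b} → x ≤ a → x ≤ b → x ≤ a ∧ b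
  ∧-greatest {x} x≤a x≤b = ⋀-greatest _ x λ
    { _ (inj₁ z≈a) → trans x≤a (reflexive (Eq.sym z≈a))
    ; _ (inj₂ z≈b) → trans x≤b (reflexive (Eq.sym z≈b)) }

  ≈⋁∧≤⇒≈ : ∀ {T : Pred Carrier ℓ} {k t} → k ≈ ⋁ T → T t → k ≤ t → k ≈ t
  ≈⋁∧≤⇒≈ {T} {t = t} k≈⋁T Tt k≤t =
    antisym k≤t (trans (⋁-upper T t Tt) (reflexive (Eq.sym k≈⋁T)))

  ≰⋀⇒≰-member : ExcludedMiddle ℓ → ∀ {y} {O : Pred Carrier ℓ} → ¬ (y ≤ ⋀ O) →
                Σ Carrier λ u → O u × ¬ (y ≤ u)
  ≰⋀⇒≰-member em {y} {O} y≰⋀O =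
    dne λ ∄u → y≰⋀O (⋀-greatest O y λ u Ou → dne λ y≰u → ∄u (u , Ou , y≰u))
    where dne = em⇒dne em

  ⋁-mono : ∀ {S T : Pred Carrier ℓ} → S ⊆ T → ⋁ S ≤ ⋁ T
  ⋁-mono {S} {T} S⊆T = ⋁-least S (⋁ T) λ x Sx → ⋁-upper T x (S⊆T Sx)

module CanonicalExtensionProperties
    {ℓ} {L : BoundedLattice ℓ ℓ ℓ} {C : CompleteLattice ℓ}
    {e : BoundedLattice.Carrier L → CompleteLattice.Carrier C}
    (ce : IsCanonicalExtension L C e) where
  private
    module L = BoundedLattice L
  open CompleteLattice C
  open IsPartialOrder isPartialOrder
  open CompleteLatticeProperties C
  open IsCanonicalExtension ce

  image-⊆ : ∀ {S U : Pred L.Carrier ℓ} → S ⊆ U → image L C e S ⊆ image L C e U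
  image-⊆ S⊆U (a , Sa , ea≈c) = a , S⊆U Sa , ea≈c

  e-≤⋁image : ∀ {S a} → S a → e a ≤ ⋁ (image L C e S)
  e-≤⋁image {S} {a} Sa = ⋁-upper _ (e a) (a , Sa , Eq.refl)

  ⋀image-≤e : ∀ {S a} → S a → ⋀ (image L C e S) ≤ e a
  ⋀image-≤e {S} {a} Sa = ⋀-lower _ (e a) (a , Sa , Eq.refl)

  ⋀image-≤e-⋀L-fin : ∀ {S xs} → All S xs → ⋀ (image L C e S) ≤ e (⋀L-fin L C xs)
  ⋀image-≤e-⋀L-fin []         = trans (⊤C-greatest _) (reflexive (Eq.sym e-⊤))
  ⋀image-≤e-⋀L-fin (Sa ∷ Sxs) =
    trans (∧-greatest (⋀image-≤e Sa) (⋀image-≤e-⋀L-fin Sxs)) (reflexive (Eq.sym (e-∧ _ _)))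

  closed-compact : ∀ {k} → IsClosed L C e k → ∀ U → k ≤ ⋁ (image L C e U) →
                   Σ (List L.Carrier) λ xs → All U xs × k ≤ e (⋁L-fin L C xs)
  closed-compact (S , k≈⋀S) U k≤⋁U
    with compact S U (trans (reflexive (Eq.sym k≈⋀S)) k≤⋁U)
  ... | ys , xs , Sys , Uxs , ⋀ys≤⋁xs =
    xs , Uxs , trans (reflexive k≈⋀S) (trans (⋀image-≤e-⋀L-fin Sys) (e-mono ⋀ys≤⋁xs))

  prime-≤e-⋁L-fin : ∀ {k} → FinitelyPrime C k → ∀ xs → k ≤ e (⋁L-fin L C xs) →
                    Any (λ a → k ≤ e a) xs
  prime-≤e-⋁L-fin (k≉⊥ , _) [] k≤e⊥ =
    ⊥-elim (k≉⊥ (antisym (trans k≤e⊥ (reflexive e-⊥)) (⊥C-least _)))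
  prime-≤e-⋁L-fin k-prime@(_ , k-split) (a ∷ xs) k≤e[a∨⋁xs]
    with k-split (e a) _ (trans k≤e[a∨⋁xs] (reflexive (e-∨ a _)))
  ... | inj₁ k≤ea    = here k≤ea
  ... | inj₂ k≤e⋁xs = there (prime-≤e-⋁L-fin k-prime xs k≤e⋁xs)

  closed-prime-≤⋁image : ∀ {k} → IsClosed L C e k → FinitelyPrime C k →
                         ∀ U → k ≤ ⋁ (image L C e U) → Σ L.Carrier λ a → U a × k ≤ e a
  closed-prime-≤⋁image k-closed k-prime U k≤⋁U
    with closed-compact k-closed U k≤⋁U
  ... | xs , Uxs , k≤e⋁xs =
    Any.lookup k≤ea-somewhere , lookupAny Uxs k≤ea-somewhere
    where k≤ea-somewhere = prime-≤e-⋁L-fin k-prime xs k≤e⋁xs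

  open-≰⇒≤⋁image-≰ : ∀ {y u} → IsOpen L C e u → ¬ (y ≤ u) →
                     u ≤ ⋁ (image L C e (λ a → ¬ (y ≤ e a)))
  open-≰⇒≤⋁image-≰ (S , u≈⋁S) y≰u =
    trans (reflexive u≈⋁S) (⋁-mono (image-⊆ λ Sa y≤ea →
      y≰u (trans y≤ea (trans (e-≤⋁image Sa) (reflexive (Eq.sym u≈⋁S))))))

  ≰⇒≤⋁image-≰ : ExcludedMiddle ℓ → ∀ {y x} → ¬ (y ≤ x) →
                x ≤ ⋁ (image L C e (λ a → ¬ (y ≤ e a)))
  ≰⇒≤⋁image-≰ em {y} {x} y≰x with dense-joins x
  ... | O , O-open , x≈⋀O
    with ≰⋀⇒≰-member em (λ y≤⋀O → y≰x (trans y≤⋀O (reflexive (Eq.sym x≈⋀O))))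
  ... | u , Ou , y≰u =
    trans (reflexive x≈⋀O) (trans (⋀-lower O u Ou) (open-≰⇒≤⋁image-≰ (O-open u Ou) y≰u))

  closed-prime-≰⋁ : ExcludedMiddle ℓ → ∀ {k} → IsClosed L C e k → FinitelyPrime C k →
                    ∀ (T : Pred Carrier ℓ) → (∀ t → T t → ¬ (k ≤ t)) → ¬ (k ≤ ⋁ T)
  closed-prime-≰⋁ em k-closed k-prime T k≰T k≤⋁T
    with closed-prime-≤⋁image k-closed k-prime _
           (trans k≤⋁T (⋁-least T _ λ t Tt → ≰⇒≤⋁image-≰ em (k≰T t Tt)))
  ... | a , k≰ea , k≤ea = k≰ea k≤ea

lemma2p4 : ∀ {ℓ : Level} → ExcludedMiddle (suc ℓ) →
    (L : BoundedLattice ℓ ℓ ℓ) (C : CompleteLattice ℓ)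
    (e : BoundedLattice.Carrier L → CompleteLattice.Carrier C) →
    IsCanonicalExtension L C e →
    (k : CompleteLattice.Carrier C) →
    IsClosed L C e k → FinitelyPrime C k →
    CompletelyJoinIrreducible C k
lemma2p4 em L C e ce k k-closed k-prime T k≈⋁T
  with em {Lift _ (Σ Carrier λ t → T t × k ≈ t)}
  where open CompleteLattice C
... | yes (lift k∈T) = k∈T
... | no k∉T = ⊥-elim (closed-prime-≰⋁ (ExcludedMiddle-lower em) k-closed k-prime T
                         (λ t Tt k≤t → k∉T (lift (t , Tt , ≈⋁∧≤⇒≈ k≈⋁T Tt k≤t)))
                         (reflexive k≈⋁T))
  where
    open CompleteLattice C
    open IsPartialOrder isPartialOrder
    open CompleteLatticeProperties C
    open CanonicalExtensionProperties ce
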